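{- Let $\mathfrak{T}=(T;<)$ be a tree. For $t\in T$ let $T^{\leqslant t}=\{x\in T:x\leqslant t\}$ and let $F_T=\bigcup\{\,2^{T^{\leqslant t}}:t\in T\,\}$, where $2^X$ is the set of all functions $X\to\{0,1\}$; order $F_T$ by $\subset$, where $f\subset g$ means that $g$ properly extends $f$ (the domain of $f$ is a proper subset of that of $g$ and $f$ is the restriction of $g$). Define $\sigma:F_T\to T$ by $\sigma(f)=t$ for all $f\in 2^{T^{\leqslant t}}$. Then: (1) $\sigma$ is order-preserving, i.e. $f\subset g$ implies $\sigma(f)<\sigma(g)$; (2) for every path $\tilde P$ in $(F_T;\subset)$, $\sigma(\tilde P)$ is a path in $\mathfrak{T}$ and the restriction of $\sigma$ to $\tilde P$ is an order isomorphism from $\tilde P$ onto $\sigma(\tilde P)$; (3) every path in $\mathfrak{T}$ is the $\sigma$-image of some path in $(F_T;\subset)$.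
   Context: A forest is a strict partial order $(F;<)$ such that for every $x$ the set $\{y:y<x\}$ is linearly ordered; a tree is a forest that is downward-connected: for all $x,y$ there is $z$ with $z\leqslant x$ and $z\leqslant y$. Trees are not assumed well-founded or rooted. A path in a partial order is a maximal linearly ordered subset. -}

module Defs where

open import Data.Bool using (Bool)
open import Data.Product using (Σ; ∃; _×_; _,_; proj₁; proj₂)
open import Data.Sum using (_⊎_)
open import Relation.Nullary using (¬_)
open import Relation.Binary.PropositionalEquality using (_≡_)

_≤[_]_ : {T : Set} → T → (T → T → Set) → T → Set
x ≤[ _<_ ] y = x < y ⊎ x ≡ y

record IsStrictPartialOrder {T : Set} (_<_ : T → T → Set) : Set where
  field
    irrefl : ∀ x → ¬ (x < x)
    trans  : ∀ {x y z} → x < y → y < z → x < z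

record IsForest {T : Set} (_<_ : T → T → Set) : Set where
  field
    spo    : IsStrictPartialOrder _<_
    linear : ∀ {x y z} → y < x → z < x → (y < z ⊎ y ≡ z ⊎ z < y)

-- Tree: downward-connected forest (not assumed rooted or well-founded).
record IsTree {T : Set} (_<_ : T → T → Set) : Set where
  field
    forest    : IsForest _<_
    connected : ∀ x y → ∃ λ z → (z ≤[ _<_ ] x) × (z ≤[ _<_ ] y)

module Order {A : Set} (_≈_ : A → A → Set) (_<_ : A → A → Set) where

  Comparable : A → A → Set
  Comparable x y = x < y ⊎ x ≈ y ⊎ y < x

  IsChain : (A → Set) → Set
  IsChain P = ∀ x y → P x → P y → Comparable x y

  IsPath : (A → Set) → Set
  IsPath P = IsChain P × (∀ z → (∀ x → P x → Comparable z x) → P z)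

module FT {T : Set} (_<_ : T → T → Set) where

  _≤_ : T → T → Set
  x ≤ y = x ≤[ _<_ ] y

  Down : T → T → Set
  Down t x = x ≤ t

  F : Set
  F = Σ T λ t → ((x : T) → x ≤ t → Bool)

  σ : F → T
  σ = proj₁

  fun : (f : F) → (x : T) → x ≤ σ f → Bool
  fun = proj₂

  -- equality of elements of F_T (as functions: same domain, same values)
  _≈_ : F → F → Set
  f ≈ g = (σ f ≡ σ g) × (∀ x (p : x ≤ σ f) (q : x ≤ σ g) → fun f x p ≡ fun g x q)

  _⊂_ : F → F → Set
  f ⊂ g = (∀ x → x ≤ σ f → x ≤ σ g)
        × (∃ λ x → x ≤ σ g × ¬ (x ≤ σ f))
        × (∀ x (p : x ≤ σ f) (q : x ≤ σ g) → fun f x p ≡ fun g x q)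

  Image : (F → Set) → T → Set
  Image P̃ t = ∃ λ f → P̃ f × σ f ≡ t

  module OT = Order {T} _≡_ _<_
  module OF = Order {F} _≈_ _⊂_

-- A proper extension has a strictly larger domain T^{≤t}, so σ is monotone. Any two members
-- of a chain in F_T agree on their common domain, so a chain is determined by its σ-image
-- together with the union of its functions; a path therefore contains the restriction of that
-- union to T^{≤t} for every t comparable with its image, which makes the image a path. The
-- union is defined by deciding membership in the domain of the chain, hence excluded middle.
-- Conversely, the zero functions on the down-sets of a path of T form a path of F_T.
module Submission where

open import Defs
open import Axiom.ExcludedMiddle using (ExcludedMiddle)
open import Data.Product using (Σ; ∃; _×_; _,_; proj₁; proj₂)
open import Data.Sum using (inj₁; inj₂)
open import Data.Bool using (Bool; false)
open import Data.Empty using (⊥-elim)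
open import Relation.Nullary using (¬_; yes; no)
open import Function.Bundles using (_⇔_; mk⇔)
open import Relation.Binary.PropositionalEquality using (_≡_; refl; sym; trans; subst)
open import Level using (0ℓ)

module _ {T : Set} {_<_ : T → T → Set} (spo : IsStrictPartialOrder _<_) where
  open IsStrictPartialOrder spo renaming (trans to <-trans)
  open FT _<_

  ≤-trans : ∀ {x y z} → x ≤ y → y ≤ z → x ≤ z
  ≤-trans (inj₁ x<y) (inj₁ y<z) = inj₁ (<-trans x<y y<z)
  ≤-trans (inj₁ x<y) (inj₂ refl) = inj₁ x<y
  ≤-trans (inj₂ refl) y≤z = y≤z

  <⇒≱ : ∀ {x y} → x < y → ¬ (y ≤ x)
  <⇒≱ {x} x<y (inj₁ y<x) = irrefl x (<-trans x<y y<x)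
  <⇒≱ {x} x<y (inj₂ refl) = irrefl x x<y

  σ-mono : ∀ f g → f ⊂ g → σ f < σ g
  σ-mono f g (dom⊆ , (x , x≤g , x≰f) , _) with dom⊆ (σ f) (inj₂ refl)
  ... | inj₁ f<g = f<g
  ... | inj₂ f≡g = ⊥-elim (x≰f (subst (x ≤_) (sym f≡g) x≤g))

  σ-comparable : ∀ f g → OF.Comparable f g → OT.Comparable (σ f) (σ g)
  σ-comparable f g (inj₁ f⊂g) = inj₁ (σ-mono f g f⊂g)
  σ-comparable f g (inj₂ (inj₁ f≈g)) = inj₂ (inj₁ (proj₁ f≈g))
  σ-comparable f g (inj₂ (inj₂ g⊂f)) = inj₂ (inj₂ (σ-mono g f g⊂f))

  Coherent : F → F → Set
  Coherent f g = ∀ x (p : x ≤ σ f) (q : x ≤ σ g) → fun f x p ≡ fun g x q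

  coherent-sym : ∀ {f g} → Coherent f g → Coherent g f
  coherent-sym coh x p q = sym (coh x q p)

  coherent⇒⊂ : ∀ f g → σ f < σ g → Coherent f g → f ⊂ g
  coherent⇒⊂ f g f<g coh = (λ x x≤f → ≤-trans x≤f (inj₁ f<g)) , (σ g , inj₂ refl , <⇒≱ f<g) , coh

  coherent-comparable : ∀ f g → Coherent f g → OT.Comparable (σ f) (σ g) → OF.Comparable f g
  coherent-comparable f g coh (inj₁ f<g) = inj₁ (coherent⇒⊂ f g f<g coh)
  coherent-comparable f g coh (inj₂ (inj₁ f≡g)) = inj₂ (inj₁ (f≡g , coh))
  coherent-comparable f g coh (inj₂ (inj₂ g<f)) = inj₂ (inj₂ (coherent⇒⊂ g f g<f (coherent-sym coh)))

  module Chain (P̃ : F → Set) (chain : OF.IsChain P̃) where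

    chain-coherent : ∀ {f g} → P̃ f → P̃ g → Coherent f g
    chain-coherent {f} {g} f∈ g∈ with chain f g f∈ g∈
    ... | inj₁ f⊂g = proj₂ (proj₂ f⊂g)
    ... | inj₂ (inj₁ f≈g) = proj₂ f≈g
    ... | inj₂ (inj₂ g⊂f) = coherent-sym (proj₂ (proj₂ g⊂f))

    image-isChain : OT.IsChain (Image P̃)
    image-isChain _ _ (f , f∈ , refl) (g , g∈ , refl) = σ-comparable f g (chain f g f∈ g∈)

    σ-⊂⇔< : ∀ f g → P̃ f → P̃ g → (f ⊂ g ⇔ σ f < σ g)
    σ-⊂⇔< f g f∈ g∈ = mk⇔ (σ-mono f g) (λ f<g → coherent⇒⊂ f g f<g (chain-coherent f∈ g∈))

    σ-injective : ∀ f g → P̃ f → P̃ g → σ f ≡ σ g → f ≈ g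
    σ-injective f g f∈ g∈ f≡g = f≡g , chain-coherent f∈ g∈

  module Path (lem : ExcludedMiddle 0ℓ) (P̃ : F → Set) (path : OF.IsPath P̃) where
    open Chain P̃ (proj₁ path)

    ⋃ : T → Bool
    ⋃ x with lem {∃ λ f → P̃ f × x ≤ σ f}
    ... | yes (f , _ , x≤f) = fun f x x≤f
    ... | no _ = false

    ⋃-extends : ∀ {f} → P̃ f → ∀ x p → fun f x p ≡ ⋃ x
    ⋃-extends {f} f∈ x p with lem {∃ λ f → P̃ f × x ≤ σ f}
    ... | yes (g , g∈ , q) = chain-coherent f∈ g∈ x p q
    ... | no ∉ = ⊥-elim (∉ (f , f∈ , p))

    image-maximal : ∀ t → (∀ s → Image P̃ s → OT.Comparable t s) → Image P̃ t
    image-maximal t cmp = g , proj₂ path g g-comparable , refl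
      where
      g : F
      g = t , λ x _ → ⋃ x

      g-comparable : ∀ f → P̃ f → OF.Comparable g f
      g-comparable f f∈ = coherent-comparable g f (λ x p q → sym (⋃-extends f∈ x q)) (cmp (σ f) (f , f∈ , refl))

    image-isPath : OT.IsPath (Image P̃)
    image-isPath = image-isChain , image-maximal

  module ZeroLift (P : T → Set) (path : OT.IsPath P) where

    P̃ : F → Set
    P̃ f = P (σ f) × (∀ x p → fun f x p ≡ false)

    zero : T → F
    zero t = t , λ _ _ → false

    zero-∈ : ∀ {t} → P t → P̃ (zero t)
    zero-∈ t∈ = t∈ , λ _ _ → refl

    isChain : OF.IsChain P̃
    isChain f g (f∈ , f≡0) (g∈ , g≡0) =
      coherent-comparable f g (λ x p q → trans (f≡0 x p) (sym (g≡0 x q))) (proj₁ path (σ f) (σ g) f∈ g∈)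

    maximal : ∀ z → (∀ f → P̃ f → OF.Comparable z f) → P̃ z
    maximal z cmp = z∈ , z≡0
      where
      z∈ : P (σ z)
      z∈ = proj₂ path (σ z) λ s s∈ → σ-comparable z (zero s) (cmp (zero s) (zero-∈ s∈))

      z≡0 : ∀ x p → fun z x p ≡ false
      z≡0 x p with cmp (zero (σ z)) (zero-∈ z∈)
      ... | inj₁ z⊂0 = ⊥-elim (irrefl (σ z) (σ-mono z (zero (σ z)) z⊂0))
      ... | inj₂ (inj₁ z≈0) = proj₂ z≈0 x p p
      ... | inj₂ (inj₂ 0⊂z) = ⊥-elim (irrefl (σ z) (σ-mono (zero (σ z)) z 0⊂z))

    isPath : OF.IsPath P̃
    isPath = isChain , maximal

    image : ∀ t → P t ⇔ Image P̃ t
    image t = mk⇔ (λ t∈ → zero t , zero-∈ t∈ , refl) λ { (f , (f∈ , _) , refl) → f∈ }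

proposition5p4 : ExcludedMiddle 0ℓ →
    (T : Set) (_<_ : T → T → Set) → IsTree _<_ →
    -- (1) σ is order-preserving
    (∀ (f g : FT.F _<_) → FT._⊂_ _<_ f g → FT.σ _<_ f < FT.σ _<_ g)
    -- (2) σ maps each path of F_T to a path of T, order-isomorphically
    × (∀ (P̃ : FT.F _<_ → Set) → Order.IsPath (FT._≈_ _<_) (FT._⊂_ _<_) P̃ →
        Order.IsPath _≡_ _<_ (FT.Image _<_ P̃)
        × (∀ f g → P̃ f → P̃ g → (FT._⊂_ _<_ f g ⇔ FT.σ _<_ f < FT.σ _<_ g))
        × (∀ f g → P̃ f → P̃ g → FT.σ _<_ f ≡ FT.σ _<_ g → FT._≈_ _<_ f g))
    -- (3) every path of T is the σ-image of a path of F_T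
    × (∀ (P : T → Set) → Order.IsPath _≡_ _<_ P →
        Σ (FT.F _<_ → Set) λ P̃ → Order.IsPath (FT._≈_ _<_) (FT._⊂_ _<_) P̃
          × (∀ t → P t ⇔ FT.Image _<_ P̃ t))
proposition5p4 lem T _<_ tree =
    σ-mono spo
  , (λ P̃ path → let open Chain spo P̃ (proj₁ path) in
       Path.image-isPath spo lem P̃ path , σ-⊂⇔< , σ-injective)
  , (λ P path → let open ZeroLift spo P path in P̃ , isPath , image)
  where
  spo : IsStrictPartialOrder _<_
  spo = IsForest.spo (IsTree.forest tree)
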